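{- The map $K$ from the set of diversified elements of $\mathbf{S}$ to FTP is one-one: for diversified $\mathbf{S}$-terms $t,s$, if $\kappa(t)=\kappa(s)$ then $[t]=[s]$.
   Context: A relation is a pair $\langle R,X\rangle$ with $R\subseteq X^2$; $X$ is its domain. For relations $\langle R,X\rangle,\langle S,Y\rangle$ with $X\cap Y=\emptyset$ define $\langle R,X\rangle+\langle S,Y\rangle=\langle R\cup S,X\cup Y\rangle$ and $\langle R,X\rangle\cdot\langle S,Y\rangle=\langle R\cup S\cup(X\times Y),X\cup Y\rangle$. Partial orders are strict (irreflexive and transitive). A relation $\langle R,X\rangle$ is trifunctional if for all $x,y,z,u\in X$: if $(x,z),(y,z),(y,u)\in R$ then $(x,u)\in R$ or $(y,x)\in R$ or $(u,z)\in R$. Fix an infinite set of variables ($\mathbf{S}$-variables). $\mathbf{S}$-terms are built from $\mathbf{S}$-variables with binary operations $+$ and $\cdot$. Let $\equiv$ be the least congruence on $\mathbf{S}$-terms making $+$ associative and commutative and $\cdot$ associative; $[t]$ is the $\equiv$-class of $t$, and $\mathbf{S}$ (the free such algebra) consists of these classes. An $\mathbf{S}$-term is diversified if no $\mathbf{S}$-variable occurs in it more than once; $[t]$ is diversified if $t$ is. FTP is the set of trifunctional partial orders $\langle R,X\rangle$ with $X$ a nonempty finite set of $\mathbf{S}$-variables. For diversified $t$ define $\kappa(x)=\langle\emptyset,\{x\}\rangle$, $\kappa(t+s)=\kappa(t)+\kappa(s)$, $\kappa(t\cdot s)=\kappa(t)\cdot\kappa(s)$; this lands in FTP and induces $K[t]=\kappa(t)$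 on diversified elements of $\mathbf{S}$. -}

module Defs where

open import Data.Nat using (ℕ)
open import Data.List using (List; []; _∷_; _++_)
open import Data.List.Membership.Propositional using (_∈_)
open import Data.List.Relation.Unary.Unique.Propositional using (Unique)
open import Data.Product using (_×_)
open import Data.Sum using (_⊎_)
open import Data.Empty using (⊥)
open import Function.Bundles using (_⇔_)

Var : Set
Var = ℕ

infixl 6 _⊕_
infixl 7 _⊙_
data Term : Set where
  var : Var → Term
  _⊕_ : Term → Term → Term
  _⊙_ : Term → Term → Term

-- ≡ : least congruence making ⊕ associative and commutative, ⊙ associative.
-- [t] = [s] is rendered as  t ≈ₛ s.
infix 4 _≈ₛ_
data _≈ₛ_ : Term → Term → Set where
  refl≈  : ∀ {t} → t ≈ₛ t
  sym≈   : ∀ {t s} → t ≈ₛ s → s ≈ₛ t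
  trans≈ : ∀ {t s u} → t ≈ₛ s → s ≈ₛ u → t ≈ₛ u
  ⊕-cong : ∀ {t t' s s'} → t ≈ₛ t' → s ≈ₛ s' → t ⊕ s ≈ₛ t' ⊕ s'
  ⊙-cong : ∀ {t t' s s'} → t ≈ₛ t' → s ≈ₛ s' → t ⊙ s ≈ₛ t' ⊙ s'
  ⊕-assoc : ∀ t s u → (t ⊕ s) ⊕ u ≈ₛ t ⊕ (s ⊕ u)
  ⊕-comm  : ∀ t s → t ⊕ s ≈ₛ s ⊕ t
  ⊙-assoc : ∀ t s u → (t ⊙ s) ⊙ u ≈ₛ t ⊙ (s ⊙ u)

vars : Term → List Var
vars (var x) = x ∷ []
vars (t ⊕ s) = vars t ++ vars s
vars (t ⊙ s) = vars t ++ vars s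

Diversified : Term → Set
Diversified t = Unique (vars t)

-- κ(t) = ⟨ κRel t , κDom t ⟩, relations represented as predicates
-- domain of κ(t): the set of variables occurring in t
κDom : Term → Var → Set
κDom t x = x ∈ vars t

κRel : Term → Var → Var → Set
κRel (var x) a b = ⊥
κRel (t ⊕ s) a b = κRel t a b ⊎ κRel s a b
κRel (t ⊙ s) a b = κRel t a b ⊎ κRel s a b ⊎ (κDom t a × κDom s b)

_≡κ_ : Term → Term → Set
t ≡κ s = (∀ x → κDom t x ⇔ κDom s x) × (∀ x y → κRel t x y ⇔ κRel s x y)

-- If t = t₁ ∘ t₂ (∘ ∈ {⊕, ⊙}) and s is
-- κ-equal to t, colour each variable by whether it occurs in t₁ (side
-- true) or not (side false).  The restriction s ↾ b of s to the variables
-- of side b is again a (possibly empty) diversified term, and restriction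
-- respects κ-equality, so s ↾ true and s ↾ false are κ-equal to t₁ and t₂
-- and hence, by induction, ≈ₛ-equal to them.  It remains to recover s
-- from its two sides: if no edge of κ(s) crosses between the sides then
-- s ≈ₛ (s ↾ true) ⊕ (s ↾ false), and if every variable of side true
-- points to every variable of side false then s ≈ₛ (s ↾ true) ⊙ (s ↾ false).
-- Possibly empty terms are modelled by freely adjoining a unit to the
-- term semigroups (Algebra.Construct.Add.Identity), so that both
-- decompositions follow by induction on s from interchange laws of the
-- resulting monoids.

module Submission where

open import Defs
open import Level using (_⊔_; 0ℓ)
open import Algebra.Bundles using (Semigroup; Monoid; CommutativeSemigroup; CommutativeMonoid)
open import Algebra.Construct.Add.Identity using (liftOp; isMonoid)
open import Algebra.Definitions using (Commutative)
import Algebra.Properties.CommutativeSemigroup as CommutativeSemigroupProperties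
open import Data.Bool using (Bool; true; false)
open import Data.Bool.Properties using (not-¬) renaming (_≟_ to _≟ᵇ_)
open import Data.Nat using () renaming (_≟_ to _≟ℕ_)
open import Data.List using (List; []; _∷_; _++_; filter)
open import Data.List.Properties using (filter-++; ++-identityʳ)
open import Data.List.Membership.Propositional using (_∈_; find; lose)
open import Data.List.Membership.Propositional.Properties using (∉[]; ∈-++⁺ˡ; ∈-++⁺ʳ; ∈-++⁻; ∈-filter⁺; ∈-filter⁻)
open import Data.List.Membership.DecPropositional _≟ℕ_ using (_∈?_)
open import Data.List.Relation.Unary.Any using (here; there; any?)
import Data.List.Relation.Unary.All as All
import Data.List.Relation.Unary.All.Properties as All
open import Data.List.Relation.Unary.AllPairs using ([]; _∷_)
open import Data.List.Relation.Unary.Unique.Propositional using (Unique)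
import Data.List.Relation.Unary.Unique.Propositional.Properties as Unique
open import Data.List.Relation.Binary.Disjoint.Propositional using (Disjoint)
open import Data.Product using (_×_; _,_; proj₁; proj₂; map; map₁; ∃-syntax)
open import Data.Product.Function.NonDependent.Propositional using (_×-⇔_)
open import Data.Sum using (_⊎_; inj₁; inj₂)
open import Data.Empty using (⊥; ⊥-elim)
open import Function using (_∘_)
open import Function.Bundles using (_⇔_; mk⇔; Equivalence)
import Function.Properties.Equivalence as ⇔
open import Relation.Nullary using (¬_; yes; no; does)
open import Relation.Nullary.Decidable using (dec-true; dec-false)
open import Relation.Nullary.Construct.Add.Point using (Pointed; [_]) renaming (∙ to ∅)
import Relation.Binary.Construct.Add.Point.Equality as PointEquality
open import Relation.Binary.Structures using (IsEquivalence)
open import Relation.Binary.PropositionalEquality using (_≡_; _≢_; refl; sym; trans; cong₂; subst; module ≡-Reasoning)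
open import Relation.Unary using (Decidable)

module _ {A : Set} where

  unique-++ˡ : ∀ {xs ys : List A} → Unique (xs ++ ys) → Unique xs
  unique-++ˡ {[]}     _         = []
  unique-++ˡ {x ∷ xs} (x∉ ∷ u) = All.++⁻ˡ xs x∉ ∷ unique-++ˡ u

  unique-++ʳ : ∀ (xs : List A) {ys} → Unique (xs ++ ys) → Unique ys
  unique-++ʳ []       u       = u
  unique-++ʳ (x ∷ xs) (_ ∷ u) = unique-++ʳ xs u

  unique-++-disjoint : ∀ {xs ys : List A} → Unique (xs ++ ys) → Disjoint xs ys
  unique-++-disjoint {x ∷ xs} (x∉ ∷ _) (here refl , q) = All.lookup (All.++⁻ʳ xs x∉) q refl
  unique-++-disjoint {x ∷ xs} (_ ∷ u)  (there p   , q) = unique-++-disjoint u (p , q)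

module _ {c ℓ} (S : CommutativeSemigroup c ℓ) where
  open CommutativeSemigroup S using (_≈_; _∙_; comm; isSemigroup) renaming (refl to ≈-refl)
  open PointEquality _≈_ using (_≈∙_; ∙≈∙; [_])

  liftOp-comm : Commutative _≈∙_ (liftOp _∙_)
  liftOp-comm [ a ] [ b ] = [ comm a b ]
  liftOp-comm [ a ] ∅     = [ ≈-refl ]
  liftOp-comm ∅     [ b ] = [ ≈-refl ]
  liftOp-comm ∅     ∅     = ∙≈∙

  pointedCommutativeMonoid : CommutativeMonoid c (c ⊔ ℓ)
  pointedCommutativeMonoid = record
    { isCommutativeMonoid = record { isMonoid = isMonoid isSemigroup ; comm = liftOp-comm } }

module _ {m ℓ} (M : Monoid m ℓ) where
  open Monoid M using (_≈_; _∙_; ε; setoid; ∙-congˡ; ∙-congʳ; identityˡ; identityʳ; assoc)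
  open import Relation.Binary.Reasoning.Setoid setoid

  interchange-unit : ∀ a b c d → b ≡ ε ⊎ c ≡ ε → (a ∙ c) ∙ (b ∙ d) ≈ (a ∙ b) ∙ (c ∙ d)
  interchange-unit a _ c d (inj₁ refl) = begin
    (a ∙ c) ∙ (ε ∙ d)  ≈⟨ ∙-congˡ (identityˡ d) ⟩
    (a ∙ c) ∙ d        ≈⟨ assoc a c d ⟩
    a ∙ (c ∙ d)        ≈⟨ ∙-congʳ (identityʳ a) ⟨
    (a ∙ ε) ∙ (c ∙ d)  ∎
  interchange-unit a b _ d (inj₂ refl) = begin
    (a ∙ ε) ∙ (b ∙ d)  ≈⟨ ∙-congʳ (identityʳ a) ⟩
    a ∙ (b ∙ d)        ≈⟨ assoc a b d ⟨
    (a ∙ b) ∙ d        ≈⟨ ∙-congˡ (identityˡ d) ⟨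
    (a ∙ b) ∙ (ε ∙ d)  ∎

≈ₛ-isEquivalence : IsEquivalence _≈ₛ_
≈ₛ-isEquivalence = record { refl = refl≈ ; sym = sym≈ ; trans = trans≈ }

⊕-commutativeSemigroup : CommutativeSemigroup 0ℓ 0ℓ
⊕-commutativeSemigroup = record
  { _∙_ = _⊕_
  ; isCommutativeSemigroup = record
    { isSemigroup = record
      { isMagma = record { isEquivalence = ≈ₛ-isEquivalence ; ∙-cong = ⊕-cong }
      ; assoc   = ⊕-assoc
      }
    ; comm = ⊕-comm
    }
  }

⊙-semigroup : Semigroup 0ℓ 0ℓ
⊙-semigroup = record
  { _∙_ = _⊙_
  ; isSemigroup = record
    { isMagma = record { isEquivalence = ≈ₛ-isEquivalence ; ∙-cong = ⊙-cong }
    ; assoc   = ⊙-assoc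
    }
  }

-- A part is a possibly empty term, ∅ being the empty one; parts carry the
-- operations and the equivalence of terms, extended to ∅ as a unit.
Part : Set
Part = Pointed Term

open PointEquality _≈ₛ_ using ([_]; [≈]-injective) renaming (_≈∙_ to _≈ᵖ_)

_⊕ᵖ_ _⊙ᵖ_ : Part → Part → Part
_⊕ᵖ_ = liftOp _⊕_
_⊙ᵖ_ = liftOp _⊙_

⊕ᵖ-commutativeMonoid : CommutativeMonoid 0ℓ 0ℓ
⊕ᵖ-commutativeMonoid = pointedCommutativeMonoid ⊕-commutativeSemigroup

⊙ᵖ-monoid : Monoid 0ℓ 0ℓ
⊙ᵖ-monoid = record { isMonoid = isMonoid (Semigroup.isSemigroup ⊙-semigroup) }

open CommutativeMonoid ⊕ᵖ-commutativeMonoid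
  using () renaming (reflexive to ≈ᵖ-reflexive; trans to ≈ᵖ-trans; ∙-cong to ⊕ᵖ-cong)
open Monoid ⊙ᵖ-monoid using () renaming (∙-cong to ⊙ᵖ-cong)

⊕ᵖ-interchange : ∀ a b c d → (a ⊕ᵖ b) ⊕ᵖ (c ⊕ᵖ d) ≈ᵖ (a ⊕ᵖ c) ⊕ᵖ (b ⊕ᵖ d)
⊕ᵖ-interchange = CommutativeSemigroupProperties.interchange
  (CommutativeMonoid.commutativeSemigroup ⊕ᵖ-commutativeMonoid)

varsᵖ : Part → List Var
varsᵖ ∅     = []
varsᵖ [ t ] = vars t

κRelᵖ : Part → Var → Var → Set
κRelᵖ ∅     _ _ = ⊥
κRelᵖ [ t ] x y = κRel t x y

_≅_ : Part → Part → Set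
p ≅ q = (∀ x → x ∈ varsᵖ p ⇔ x ∈ varsᵖ q) × (∀ x y → κRelᵖ p x y ⇔ κRelᵖ q x y)

varsᵖ-liftOp : ∀ {op : Term → Term → Term} → (∀ a b → vars (op a b) ≡ vars a ++ vars b)
             → ∀ p q → varsᵖ (liftOp op p q) ≡ varsᵖ p ++ varsᵖ q
varsᵖ-liftOp h [ a ] [ b ] = h a b
varsᵖ-liftOp h [ a ] ∅     = sym (++-identityʳ (vars a))
varsᵖ-liftOp h ∅     [ b ] = refl
varsᵖ-liftOp h ∅     ∅     = refl

κRelᵖ-⊕ᵖ : ∀ p q {x y} → κRelᵖ (p ⊕ᵖ q) x y ⇔ (κRelᵖ p x y ⊎ κRelᵖ q x y)
κRelᵖ-⊕ᵖ [ a ] [ b ] = ⇔.refl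
κRelᵖ-⊕ᵖ [ a ] ∅     = mk⇔ inj₁ λ { (inj₁ e) → e ; (inj₂ ()) }
κRelᵖ-⊕ᵖ ∅     [ b ] = mk⇔ inj₂ λ { (inj₁ ()) ; (inj₂ e) → e }
κRelᵖ-⊕ᵖ ∅     ∅     = mk⇔ (λ ()) λ { (inj₁ ()) ; (inj₂ ()) }

κRelᵖ-⊙ᵖ : ∀ p q {x y}
         → κRelᵖ (p ⊙ᵖ q) x y ⇔ (κRelᵖ p x y ⊎ κRelᵖ q x y ⊎ (x ∈ varsᵖ p × y ∈ varsᵖ q))
κRelᵖ-⊙ᵖ [ a ] [ b ] = ⇔.refl
κRelᵖ-⊙ᵖ [ a ] ∅     = mk⇔ inj₁ λ { (inj₁ e) → e ; (inj₂ (inj₁ ())) ; (inj₂ (inj₂ (_ , ()))) }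
κRelᵖ-⊙ᵖ ∅     [ b ] = mk⇔ (inj₂ ∘ inj₁) λ { (inj₁ ()) ; (inj₂ (inj₁ e)) → e ; (inj₂ (inj₂ (() , _))) }
κRelᵖ-⊙ᵖ ∅     ∅     = mk⇔ (λ ()) λ { (inj₁ ()) ; (inj₂ (inj₁ ())) ; (inj₂ (inj₂ (() , _))) }

some-var : ∀ t → ∃[ x ] x ∈ vars t
some-var (var x) = x , here refl
some-var (t ⊕ u) = let x , x∈t = some-var t in x , ∈-++⁺ˡ x∈t
some-var (t ⊙ u) = let x , x∈t = some-var t in x , ∈-++⁺ˡ x∈t

edge-vars : ∀ t {x y} → κRel t x y → x ∈ vars t × y ∈ vars t
edge-vars (t ⊕ u) (inj₁ e)                = map ∈-++⁺ˡ ∈-++⁺ˡ (edge-vars t e)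
edge-vars (t ⊕ u) (inj₂ e)                = map (∈-++⁺ʳ (vars t)) (∈-++⁺ʳ (vars t)) (edge-vars u e)
edge-vars (t ⊙ u) (inj₁ e)                = map ∈-++⁺ˡ ∈-++⁺ˡ (edge-vars t e)
edge-vars (t ⊙ u) (inj₂ (inj₁ e))         = map (∈-++⁺ʳ (vars t)) (∈-++⁺ʳ (vars t)) (edge-vars u e)
edge-vars (t ⊙ u) (inj₂ (inj₂ (x∈t , y∈u))) = ∈-++⁺ˡ x∈t , ∈-++⁺ʳ (vars t) y∈u

⊕-no-cross : ∀ t u {x y} → Unique (vars t ++ vars u) → κRel (t ⊕ u) x y
           → ¬ (x ∈ vars t × y ∈ vars u) × ¬ (x ∈ vars u × y ∈ vars t)
⊕-no-cross t u d (inj₁ e) =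
  (λ (_ , y∈u) → unique-++-disjoint d (proj₂ (edge-vars t e) , y∈u)) ,
  (λ (x∈u , _) → unique-++-disjoint d (proj₁ (edge-vars t e) , x∈u))
⊕-no-cross t u d (inj₂ e) =
  (λ (x∈t , _) → unique-++-disjoint d (x∈t , proj₁ (edge-vars u e))) ,
  (λ (_ , y∈t) → unique-++-disjoint d (y∈t , proj₂ (edge-vars u e)))

module _ (t u : Term) {x y : Var} (d : Unique (vars t ++ vars u)) where
  private
    disjoint : Disjoint (vars t) (vars u)
    disjoint = unique-++-disjoint d

  ⊙-edge-left : κRel (t ⊙ u) x y → x ∈ vars t → y ∈ vars t → κRel t x y
  ⊙-edge-left (inj₁ e)                _   _   = e
  ⊙-edge-left (inj₂ (inj₁ e))         x∈t _   = ⊥-elim (disjoint (x∈t , proj₁ (edge-vars u e)))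
  ⊙-edge-left (inj₂ (inj₂ (_ , y∈u))) _   y∈t = ⊥-elim (disjoint (y∈t , y∈u))

  ⊙-edge-right : κRel (t ⊙ u) x y → x ∈ vars u → y ∈ vars u → κRel u x y
  ⊙-edge-right (inj₁ e)                x∈u _ = ⊥-elim (disjoint (proj₁ (edge-vars t e) , x∈u))
  ⊙-edge-right (inj₂ (inj₁ e))         _   _ = e
  ⊙-edge-right (inj₂ (inj₂ (x∈t , _))) x∈u _ = ⊥-elim (disjoint (x∈t , x∈u))

  ⊙-no-back : κRel (t ⊙ u) x y → x ∈ vars u → y ∈ vars t → ⊥
  ⊙-no-back (inj₁ e)                x∈u _   = disjoint (proj₁ (edge-vars t e) , x∈u)
  ⊙-no-back (inj₂ (inj₁ e))         _   y∈t = disjoint (y∈t , proj₂ (edge-vars u e))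
  ⊙-no-back (inj₂ (inj₂ (x∈t , _))) x∈u _   = disjoint (x∈t , x∈u)

module Restriction (side : Var → Bool) where

  onSide? : ∀ b → Decidable (λ x → side x ≡ b)
  onSide? b x = side x ≟ᵇ b

  infix 8 _↾_
  _↾_ : Term → Bool → Part
  var x ↾ b with onSide? b x
  ... | yes _ = [ var x ]
  ... | no _  = ∅
  (t ⊕ u) ↾ b = (t ↾ b) ⊕ᵖ (u ↾ b)
  (t ⊙ u) ↾ b = (t ↾ b) ⊙ᵖ (u ↾ b)

  vars-↾ : ∀ t b → varsᵖ (t ↾ b) ≡ filter (onSide? b) (vars t)

  vars-↾-liftOp : ∀ {op : Term → Term → Term} → (∀ a b → vars (op a b) ≡ vars a ++ vars b)
                → ∀ t u b → varsᵖ (liftOp op (t ↾ b) (u ↾ b)) ≡ filter (onSide? b) (vars t ++ vars u)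
  vars-↾-liftOp h t u b = begin
    varsᵖ (liftOp _ (t ↾ b) (u ↾ b))                             ≡⟨ varsᵖ-liftOp h (t ↾ b) (u ↾ b) ⟩
    varsᵖ (t ↾ b) ++ varsᵖ (u ↾ b)                               ≡⟨ cong₂ _++_ (vars-↾ t b) (vars-↾ u b) ⟩
    filter (onSide? b) (vars t) ++ filter (onSide? b) (vars u)  ≡⟨ filter-++ (onSide? b) (vars t) (vars u) ⟨
    filter (onSide? b) (vars t ++ vars u)                       ∎
    where open ≡-Reasoning

  vars-↾ (var x) b with onSide? b x
  ... | yes _ = refl
  ... | no _  = refl
  vars-↾ (t ⊕ u) b = vars-↾-liftOp (λ _ _ → refl) t u b
  vars-↾ (t ⊙ u) b = vars-↾-liftOp (λ _ _ → refl) t u b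

  ∈-↾ : ∀ t b {x} → x ∈ varsᵖ (t ↾ b) ⇔ (x ∈ vars t × side x ≡ b)
  ∈-↾ t b {x} = mk⇔
    (λ x∈ → ∈-filter⁻ (onSide? b) (subst (x ∈_) (vars-↾ t b) x∈))
    (λ (x∈t , x∈b) → subst (x ∈_) (sym (vars-↾ t b)) (∈-filter⁺ (onSide? b) x∈t x∈b))

  unique-↾ : ∀ t b → Unique (vars t) → Unique (varsᵖ (t ↾ b))
  unique-↾ t b d = subst Unique (sym (vars-↾ t b)) (Unique.filter⁺ (onSide? b) d)

  ↾-all : ∀ t b → (∀ {x} → x ∈ vars t → side x ≡ b) → t ↾ b ≡ [ t ]
  ↾-all (var x) b all with onSide? b x
  ... | yes _   = refl
  ... | no x∉b  = ⊥-elim (x∉b (all (here refl)))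
  ↾-all (t ⊕ u) b all = cong₂ _⊕ᵖ_ (↾-all t b (λ x∈ → all (∈-++⁺ˡ x∈))) (↾-all u b (λ x∈ → all (∈-++⁺ʳ (vars t) x∈)))
  ↾-all (t ⊙ u) b all = cong₂ _⊙ᵖ_ (↾-all t b (λ x∈ → all (∈-++⁺ˡ x∈))) (↾-all u b (λ x∈ → all (∈-++⁺ʳ (vars t) x∈)))

  ↾-none : ∀ t b → (∀ {x} → x ∈ vars t → side x ≢ b) → t ↾ b ≡ ∅
  ↾-none (var x) b none with onSide? b x
  ... | yes x∈b = ⊥-elim (none (here refl) x∈b)
  ... | no _    = refl
  ↾-none (t ⊕ u) b none = cong₂ _⊕ᵖ_ (↾-none t b (λ x∈ → none (∈-++⁺ˡ x∈))) (↾-none u b (λ x∈ → none (∈-++⁺ʳ (vars t) x∈)))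
  ↾-none (t ⊙ u) b none = cong₂ _⊙ᵖ_ (↾-none t b (λ x∈ → none (∈-++⁺ˡ x∈))) (↾-none u b (λ x∈ → none (∈-++⁺ʳ (vars t) x∈)))

  ↾-empty-or-witness : ∀ t b → t ↾ b ≡ ∅ ⊎ ∃[ x ] (x ∈ vars t × side x ≡ b)
  ↾-empty-or-witness t b with any? (onSide? b) (vars t)
  ... | yes some = inj₂ (find some)
  ... | no none  = inj₁ (↾-none t b (λ x∈t x∈b → none (lose x∈t x∈b)))

  ↾-edge⁻ : ∀ t b {x y} → κRelᵖ (t ↾ b) x y → κRel t x y × side x ≡ b × side y ≡ b
  ↾-edge⁻ (var z) b e with onSide? b z
  ↾-edge⁻ (var z) b () | yes _
  ↾-edge⁻ (var z) b () | no _
  ↾-edge⁻ (t ⊕ u) b e with Equivalence.to (κRelᵖ-⊕ᵖ (t ↾ b) (u ↾ b)) e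
  ... | inj₁ eₜ = map₁ inj₁ (↾-edge⁻ t b eₜ)
  ... | inj₂ eᵤ = map₁ inj₂ (↾-edge⁻ u b eᵤ)
  ↾-edge⁻ (t ⊙ u) b e with Equivalence.to (κRelᵖ-⊙ᵖ (t ↾ b) (u ↾ b)) e
  ... | inj₁ eₜ               = map₁ inj₁ (↾-edge⁻ t b eₜ)
  ... | inj₂ (inj₁ eᵤ)        = map₁ (inj₂ ∘ inj₁) (↾-edge⁻ u b eᵤ)
  ... | inj₂ (inj₂ (x∈ , y∈)) =
    let x∈t , x∈b = Equivalence.to (∈-↾ t b) x∈
        y∈u , y∈b = Equivalence.to (∈-↾ u b) y∈
    in inj₂ (inj₂ (x∈t , y∈u)) , x∈b , y∈b

  ↾-edge⁺ : ∀ t b {x y} → κRel t x y → side x ≡ b → side y ≡ b → κRelᵖ (t ↾ b) x y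
  ↾-edge⁺ (t ⊕ u) b (inj₁ e) x∈b y∈b =
    Equivalence.from (κRelᵖ-⊕ᵖ (t ↾ b) (u ↾ b)) (inj₁ (↾-edge⁺ t b e x∈b y∈b))
  ↾-edge⁺ (t ⊕ u) b (inj₂ e) x∈b y∈b =
    Equivalence.from (κRelᵖ-⊕ᵖ (t ↾ b) (u ↾ b)) (inj₂ (↾-edge⁺ u b e x∈b y∈b))
  ↾-edge⁺ (t ⊙ u) b (inj₁ e) x∈b y∈b =
    Equivalence.from (κRelᵖ-⊙ᵖ (t ↾ b) (u ↾ b)) (inj₁ (↾-edge⁺ t b e x∈b y∈b))
  ↾-edge⁺ (t ⊙ u) b (inj₂ (inj₁ e)) x∈b y∈b =
    Equivalence.from (κRelᵖ-⊙ᵖ (t ↾ b) (u ↾ b)) (inj₂ (inj₁ (↾-edge⁺ u b e x∈b y∈b)))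
  ↾-edge⁺ (t ⊙ u) b (inj₂ (inj₂ (x∈t , y∈u))) x∈b y∈b =
    Equivalence.from (κRelᵖ-⊙ᵖ (t ↾ b) (u ↾ b))
      (inj₂ (inj₂ (Equivalence.from (∈-↾ t b) (x∈t , x∈b) , Equivalence.from (∈-↾ u b) (y∈u , y∈b))))

  ↾-edge : ∀ t b {x y} → κRelᵖ (t ↾ b) x y ⇔ (κRel t x y × side x ≡ b × side y ≡ b)
  ↾-edge t b = mk⇔ (↾-edge⁻ t b) (λ (e , x∈b , y∈b) → ↾-edge⁺ t b e x∈b y∈b)

  ↾-≅ : ∀ {t s} b → t ≡κ s → (t ↾ b) ≅ (s ↾ b)
  ↾-≅ {t} {s} b (same-vars , same-edges) =
    (λ x → ⇔.trans (∈-↾ t b) (⇔.trans (same-vars x ×-⇔ ⇔.refl) (⇔.sym (∈-↾ s b)))) ,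
    (λ x y → ⇔.trans (↾-edge t b) (⇔.trans (same-edges x y ×-⇔ ⇔.refl) (⇔.sym (↾-edge s b))))

  one-sided : ∀ op u b → (∀ {x} → x ∈ vars u → side x ≡ b) → liftOp op (u ↾ true) (u ↾ false) ≡ [ u ]
  one-sided op u true  all = cong₂ (liftOp op) (↾-all u true all) (↾-none u false (λ x∈u → not-¬ (all x∈u)))
  one-sided op u false all = cong₂ (liftOp op) (↾-none u true (λ x∈u → not-¬ (all x∈u))) (↾-all u false all)

  common-side : ∀ t u → (∀ {x y} → x ∈ vars t → y ∈ vars u → side x ≡ side y)
              → ∃[ b ] (∀ {z} → z ∈ vars t ++ vars u → side z ≡ b)
  common-side t u agree with some-var t | some-var u
  ... | x₀ , x₀∈t | y₀ , y₀∈u = side x₀ , λ z∈ → on-side (∈-++⁻ (vars t) z∈)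
    where
    on-side : ∀ {z} → z ∈ vars t ⊎ z ∈ vars u → side z ≡ side x₀
    on-side (inj₁ z∈t) = trans (agree z∈t y₀∈u) (sym (agree x₀∈t y₀∈u))
    on-side (inj₂ z∈u) = sym (agree x₀∈t z∈u)

  ⊕-decompose : ∀ s → Unique (vars s) → (∀ {x y} → κRel s x y → side x ≡ side y)
              → (s ↾ true) ⊕ᵖ (s ↾ false) ≈ᵖ [ s ]
  ⊕-decompose (var x) _ _ = ≈ᵖ-reflexive (one-sided _⊕_ (var x) (side x) λ { (here refl) → refl })
  ⊕-decompose (t ⊕ u) d uncrossed = ≈ᵖ-trans
    (⊕ᵖ-interchange (t ↾ true) (u ↾ true) (t ↾ false) (u ↾ false))
    (⊕ᵖ-cong (⊕-decompose t (unique-++ˡ d) (λ e → uncrossed (inj₁ e)))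
             (⊕-decompose u (unique-++ʳ (vars t) d) (λ e → uncrossed (inj₂ e))))
  ⊕-decompose (t ⊙ u) _ uncrossed =
    let b , all = common-side t u (λ x∈t y∈u → uncrossed (inj₂ (inj₂ (x∈t , y∈u))))
    in ≈ᵖ-reflexive (one-sided _⊕_ (t ⊙ u) b all)

  ⊙-decompose : ∀ s → Unique (vars s)
              → (∀ {x y} → x ∈ vars s → y ∈ vars s → side x ≡ true → side y ≡ false → κRel s x y)
              → (s ↾ true) ⊙ᵖ (s ↾ false) ≈ᵖ [ s ]
  ⊙-decompose (var x) _ _ = ≈ᵖ-reflexive (one-sided _⊙_ (var x) (side x) λ { (here refl) → refl })
  ⊙-decompose (t ⊕ u) d ordered =
    let b , all = common-side t u agree in ≈ᵖ-reflexive (one-sided _⊙_ (t ⊕ u) b all)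
    where
    -- opposite sides would force an edge between the summands
    agree : ∀ {x y} → x ∈ vars t → y ∈ vars u → side x ≡ side y
    agree {x} {y} x∈t y∈u with side x in x-side | side y in y-side
    ... | true  | true  = refl
    ... | false | false = refl
    ... | true  | false = ⊥-elim (proj₁ (⊕-no-cross t u d
            (ordered (∈-++⁺ˡ x∈t) (∈-++⁺ʳ (vars t) y∈u) x-side y-side)) (x∈t , y∈u))
    ... | false | true  = ⊥-elim (proj₂ (⊕-no-cross t u d
            (ordered (∈-++⁺ʳ (vars t) y∈u) (∈-++⁺ˡ x∈t) y-side x-side)) (y∈u , x∈t))
  ⊙-decompose (t ⊙ u) d ordered = ≈ᵖ-trans
    (interchange-unit ⊙ᵖ-monoid (t ↾ true) (t ↾ false) (u ↾ true) (u ↾ false) left-before-right)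
    (⊙ᵖ-cong (⊙-decompose t (unique-++ˡ d) ordered-t) (⊙-decompose u (unique-++ʳ (vars t) d) ordered-u))
    where
    ordered-t : ∀ {x y} → x ∈ vars t → y ∈ vars t → side x ≡ true → side y ≡ false → κRel t x y
    ordered-t x∈t y∈t x-side y-side =
      ⊙-edge-left t u d (ordered (∈-++⁺ˡ x∈t) (∈-++⁺ˡ y∈t) x-side y-side) x∈t y∈t
    ordered-u : ∀ {x y} → x ∈ vars u → y ∈ vars u → side x ≡ true → side y ≡ false → κRel u x y
    ordered-u x∈u y∈u x-side y-side =
      ⊙-edge-right t u d (ordered (∈-++⁺ʳ (vars t) x∈u) (∈-++⁺ʳ (vars t) y∈u) x-side y-side) x∈u y∈u
    -- t has no variable on side false or u none on side true, as otherwise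
    -- an edge would lead from u back to t
    left-before-right : t ↾ false ≡ ∅ ⊎ u ↾ true ≡ ∅
    left-before-right with ↾-empty-or-witness t false | ↾-empty-or-witness u true
    ... | inj₁ empty | _          = inj₁ empty
    ... | inj₂ _     | inj₁ empty = inj₂ empty
    ... | inj₂ (y , y∈t , y-side) | inj₂ (x , x∈u , x-side) = ⊥-elim (⊙-no-back t u d
          (ordered (∈-++⁺ʳ (vars t) x∈u) (∈-++⁺ˡ y∈t) x-side y-side) x∈u y∈t)

  side-≅ : ∀ t {s u} b → t ≡κ s → t ↾ b ≡ [ u ] → [ u ] ≅ (s ↾ b)
  side-≅ t {s} b t≡s t↾b≡u = subst (_≅ (s ↾ b)) t↾b≡u (↾-≅ b t≡s)

module SplitAt (t₁ t₂ : Term) (d : Unique (vars t₁ ++ vars t₂)) where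

  side : Var → Bool
  side x = does (x ∈? vars t₁)

  open Restriction side public

  left-side : ∀ {x} → x ∈ vars t₁ → side x ≡ true
  left-side {x} = dec-true (x ∈? vars t₁)

  right-side : ∀ {x} → x ∈ vars t₂ → side x ≡ false
  right-side {x} x∈t₂ = dec-false (x ∈? vars t₁) (λ x∈t₁ → unique-++-disjoint d (x∈t₁ , x∈t₂))

  left-of-side : ∀ {x} → side x ≡ true → x ∈ vars t₁
  left-of-side {x} x-side with x ∈? vars t₁
  ... | yes x∈t₁ = x∈t₁
  left-of-side () | no _

  right-of-side : ∀ {x} → x ∈ vars t₁ ++ vars t₂ → side x ≡ false → x ∈ vars t₂
  right-of-side x∈ x-side with ∈-++⁻ (vars t₁) x∈
  ... | inj₁ x∈t₁ = ⊥-elim (not-¬ (left-side x∈t₁) x-side)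
  ... | inj₂ x∈t₂ = x∈t₂

  left-part : ∀ op → liftOp op (t₁ ↾ true) (t₂ ↾ true) ≡ [ t₁ ]
  left-part op = cong₂ (liftOp op)
    (↾-all t₁ true left-side) (↾-none t₂ true (λ x∈ → not-¬ (right-side x∈)))

  right-part : ∀ op → liftOp op (t₁ ↾ false) (t₂ ↾ false) ≡ [ t₂ ]
  right-part op = cong₂ (liftOp op)
    (↾-none t₁ false (λ x∈ → not-¬ (left-side x∈))) (↾-all t₂ false right-side)

  sum-uncrossed : ∀ {s} → (t₁ ⊕ t₂) ≡κ s → ∀ {x y} → κRel s x y → side x ≡ side y
  sum-uncrossed (_ , same-edges) e with Equivalence.from (same-edges _ _) e
  ... | inj₁ e₁ = let x∈ , y∈ = edge-vars t₁ e₁ in trans (left-side x∈) (sym (left-side y∈))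
  ... | inj₂ e₂ = let x∈ , y∈ = edge-vars t₂ e₂ in trans (right-side x∈) (sym (right-side y∈))

  product-ordered : ∀ {s} → (t₁ ⊙ t₂) ≡κ s
                  → ∀ {x y} → x ∈ vars s → y ∈ vars s → side x ≡ true → side y ≡ false → κRel s x y
  product-ordered (same-vars , same-edges) _ y∈s x-side y-side =
    Equivalence.to (same-edges _ _) (inj₂ (inj₂
      (left-of-side x-side , right-of-side (Equivalence.from (same-vars _) y∈s) y-side)))

two-vars : ∀ t u {x} → Unique (vars t ++ vars u) → ¬ (∀ {z} → z ∈ vars t ++ vars u → z ∈ x ∷ [])
two-vars t u d only with some-var t | some-var u
... | y , y∈t | z , z∈u with only (∈-++⁺ˡ y∈t) | only (∈-++⁺ʳ (vars t) z∈u)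
... | here refl | here refl = unique-++-disjoint d (y∈t , z∈u)

only-var : ∀ x s → Unique (vars s) → (∀ {z} → z ∈ vars s → z ∈ x ∷ []) → var x ≈ₛ s
only-var x (var y) _ only with only (here refl)
... | here refl = refl≈
only-var x (t ⊕ u) d only = ⊥-elim (two-vars t u d only)
only-var x (t ⊙ u) d only = ⊥-elim (two-vars t u d only)

κ-injective : ∀ t p → Unique (vars t) → Unique (varsᵖ p) → [ t ] ≅ p → [ t ] ≈ᵖ p
κ-injective t ∅ _ _ (same-vars , _) = ⊥-elim (∉[] (Equivalence.to (same-vars _) (proj₂ (some-var t))))
κ-injective (var x) [ s ] _ d (same-vars , _) = [ only-var x s d (Equivalence.from (same-vars _)) ]
κ-injective (t₁ ⊕ t₂) [ s ] d d′ t≡s = ≈ᵖ-trans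
  (⊕ᵖ-cong
    (κ-injective t₁ (s ↾ true)  (unique-++ˡ d)          (unique-↾ s true d′)  (side-≅ (t₁ ⊕ t₂) true  t≡s (left-part _⊕_)))
    (κ-injective t₂ (s ↾ false) (unique-++ʳ (vars t₁) d) (unique-↾ s false d′) (side-≅ (t₁ ⊕ t₂) false t≡s (right-part _⊕_))))
  (⊕-decompose s d′ (sum-uncrossed t≡s))
  where open SplitAt t₁ t₂ d
κ-injective (t₁ ⊙ t₂) [ s ] d d′ t≡s = ≈ᵖ-trans
  (⊙ᵖ-cong
    (κ-injective t₁ (s ↾ true)  (unique-++ˡ d)          (unique-↾ s true d′)  (side-≅ (t₁ ⊙ t₂) true  t≡s (left-part _⊙_)))
    (κ-injective t₂ (s ↾ false) (unique-++ʳ (vars t₁) d) (unique-↾ s false d′) (side-≅ (t₁ ⊙ t₂) false t≡s (right-part _⊙_))))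
  (⊙-decompose s d′ (product-ordered t≡s))
  where open SplitAt t₁ t₂ d

proposition3p1 : ∀ (t s : Term) → Diversified t → Diversified s → t ≡κ s → t ≈ₛ s
proposition3p1 t s dt ds t≡s = [≈]-injective (κ-injective t [ s ] dt ds t≡s)
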